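{- For every set of events $cs$ and all relations $P, Q$: $P\bowtie_I^{cs}Q = Q\bowtie_I^{cs}P$. Moreover, for independent lenses $ns_1\bowtie ns_2$: $P\bowtie_F^{ns_1,cs,ns_2}Q = Q\bowtie_F^{ns_2,cs,ns_1}P$.
   Context: UTP setting: relations are predicates over undashed (initial) and dashed (final) variables; $;$ is relational composition. Observational variables include traces $tr,tr'$ (finite event sequences; $-$ removal of a prefix), state $st,st'\in\Sigma$, and refusal sets $ref,ref'$; $tt$ abbreviates $tr'-tr$. Lenses: a lens $X:V\Rightarrow\Sigma$ is a pair $get_X:\Sigma\to V$, $put_X:\Sigma\to V\to\Sigma$ with $get(put\,s\,v)=v$, $put(put\,s\,v')\,v=put\,s\,v$, $put\,s\,(get\,s)=s$. $X\bowtie Y$ (independence) iff $put_X(put_Y\,s\,v)\,u = put_Y(put_X\,s\,u)\,v$ for all $s,u,v$. Override $s_1\oplus_X s_2 = put_X\,s_1\,(get_X\,s_2)$. $\mathbf{0}$ is the lens with a singleton view ($put\,s\,v=s$). Parallel-by-merge: $P\parallel_M Q = (P_0\wedge Q_1\wedge v'=v);M$, where $v$ is the tuple of all variables, $P_0$ ($Q_1$) is $P$ ($Q$) with each dashed variable $x'$ renamed to $0.x$ ($1.x$), and $M$ relates initial variables $x,0.x,1.x$ to final variables $x'$. Trace merge $\parallel_{cs}$: least function from pairs of event sequences to sets of sequences with $\langle\rangle\parallel_{cs}\langle\rangle=\{\langle\rangle\}$; $(e{:}u)\parallel_{cs}\langle\rangle$ and $\langle\rangle\parallel_{cs}(e{:}u)$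 equal $\{\langle\rangle\}$ if $e\in cs$, otherwise $\{\langle e\rangle\}{}^\frown(u\parallel_{cs}\langle\rangle)$, resp. $\{\langle e\rangle\}{}^\frown(\langle\rangle\parallel_{cs}u)$; $(e{:}u_1)\parallel_{cs}(e{:}u_2)=\{\langle e\rangle\}{}^\frown(u_1\parallel_{cs}u_2)$ if $e\in cs$, else $\{\langle e\rangle\}{}^\frown(u_1\parallel_{cs}(e{:}u_2)\cup(e{:}u_1)\parallel_{cs}u_2)$; for $e_1\ne e_2$: $\{\langle\rangle\}$ if both in $cs$, $\{\langle e_2\rangle\}{}^\frown((e_1{:}u_1)\parallel_{cs}u_2)$ if only $e_1\in cs$, $\{\langle e_1\rangle\}{}^\frown(u_1\parallel_{cs}(e_2{:}u_2))$ if only $e_2\in cs$, and the union of these two if neither. $S{}^\frown T=\{a{}^\frown b\mid a\in S,b\in T\}$; $u\restriction cs$ is the subsequence of elements of $u$ in $cs$. Inner merge: $N(ns_1,cs,ns_2) = (tt\in0.tt\parallel_{cs}1.tt\wedge 0.tt\restriction cs = 1.tt\restriction cs\wedge ref'\subseteq((0.ref\cup1.ref)\cap cs)\cup((0.ref\cap1.ref)\setminus cs)\wedge st' = (st\oplus_{ns_1}0.st)\oplus_{ns_2}1.st)$ with $0.tt = 0.tr-tr$, $1.tt = 1.tr-tr$. $N_I = N(\mathbf{0},cs,\mathbf{0})$; $P\bowtie_I^{cs}Q = P\parallel_{\exists st'\bullet N_I}Q$; $P\bowtie_F^{ns_1,cs,ns_2}Q = P\parallel_{\exists ref'\bullet N(ns_1,cs,ns_2)}Q$.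 -}

module Defs where

open import Data.Bool using (Bool; true; false; T; _∧_; _∨_; not)
open import Data.List using (List; []; _∷_; length; drop; filterᵇ)
open import Data.Product using (Σ; ∃; _×_; _,_)
open import Data.Unit using (⊤; tt)
open import Relation.Binary.PropositionalEquality using (_≡_; _≢_)

-- Sets of events are represented by characteristic functions E → Bool.

record Lens (V S : Set) : Set where
  field
    get : S → V
    put : S → V → S
    put-get : ∀ s v → get (put s v) ≡ v
    put-put : ∀ s v v' → put (put s v') v ≡ put s v
    get-put : ∀ s → put s (get s) ≡ s
open Lens public

Indep : ∀ {V W S} → Lens V S → Lens W S → Set
Indep X Y = ∀ s u v → put X (put Y s v) u ≡ put Y (put X s u) v

_⊕[_]_ : ∀ {V S} → S → Lens V S → S → S
s₁ ⊕[ X ] s₂ = put X s₁ (get X s₂)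

zeroL : ∀ {S} → Lens ⊤ S
zeroL = record
  { get = λ _ → tt ; put = λ s _ → s
  ; put-get = λ _ _ → _≡_.refl ; put-put = λ _ _ _ → _≡_.refl ; get-put = λ _ → _≡_.refl }

record Obs (E S : Set) : Set where
  constructor obs
  field
    tr  : List E
    st  : S
    ref : E → Bool
open Obs public

Rel : Set → Set → Set₁
Rel E S = Obs E S → Obs E S → Set

_≐_ : ∀ {E S} → Rel E S → Rel E S → Set
P ≐ Q = ∀ s s' → (P s s' → Q s s') × (Q s s' → P s s')

-- Merge predicates: relate (v, 0.v, 1.v) to v'
MergeRel : Set → Set → Set₁
MergeRel E S = Obs E S → Obs E S → Obs E S → Obs E S → Set

ParBy : ∀ {E S} → MergeRel E S → Rel E S → Rel E S → Rel E S
ParBy M P Q s s' = Σ _ λ o₀ → Σ _ λ o₁ → P s o₀ × Q s o₁ × M s o₀ o₁ s'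

_-ₜ_ : ∀ {E : Set} → List E → List E → List E
t' -ₜ t = drop (length t) t'

_↾_ : ∀ {E : Set} → List E → (E → Bool) → List E
u ↾ cs = filterᵇ cs u

-- Trace merge: TMerge cs u₁ u₂ t  means  t ∈ u₁ ∥_cs u₂  (least fixed point)
data TMerge {E : Set} (cs : E → Bool) : List E → List E → List E → Set where
  nil     : TMerge cs [] [] []
  l-sync  : ∀ {e u} → cs e ≡ true → TMerge cs (e ∷ u) [] []
  l-step  : ∀ {e u t} → cs e ≡ false → TMerge cs u [] t → TMerge cs (e ∷ u) [] (e ∷ t)
  r-sync  : ∀ {e u} → cs e ≡ true → TMerge cs [] (e ∷ u) []
  r-step  : ∀ {e u t} → cs e ≡ false → TMerge cs [] u t → TMerge cs [] (e ∷ u) (e ∷ t)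
  eq-sync : ∀ {e u₁ u₂ t} → cs e ≡ true → TMerge cs u₁ u₂ t
            → TMerge cs (e ∷ u₁) (e ∷ u₂) (e ∷ t)
  eq-l    : ∀ {e u₁ u₂ t} → cs e ≡ false → TMerge cs u₁ (e ∷ u₂) t
            → TMerge cs (e ∷ u₁) (e ∷ u₂) (e ∷ t)
  eq-r    : ∀ {e u₁ u₂ t} → cs e ≡ false → TMerge cs (e ∷ u₁) u₂ t
            → TMerge cs (e ∷ u₁) (e ∷ u₂) (e ∷ t)
  ne-both : ∀ {e₁ e₂ u₁ u₂} → e₁ ≢ e₂ → cs e₁ ≡ true → cs e₂ ≡ true
            → TMerge cs (e₁ ∷ u₁) (e₂ ∷ u₂) []
  ne-fst  : ∀ {e₁ e₂ u₁ u₂ t} → e₁ ≢ e₂ → cs e₁ ≡ true → cs e₂ ≡ false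
            → TMerge cs (e₁ ∷ u₁) u₂ t → TMerge cs (e₁ ∷ u₁) (e₂ ∷ u₂) (e₂ ∷ t)
  ne-snd  : ∀ {e₁ e₂ u₁ u₂ t} → e₁ ≢ e₂ → cs e₁ ≡ false → cs e₂ ≡ true
            → TMerge cs u₁ (e₂ ∷ u₂) t → TMerge cs (e₁ ∷ u₁) (e₂ ∷ u₂) (e₁ ∷ t)
  ne-l    : ∀ {e₁ e₂ u₁ u₂ t} → e₁ ≢ e₂ → cs e₁ ≡ false → cs e₂ ≡ false
            → TMerge cs u₁ (e₂ ∷ u₂) t → TMerge cs (e₁ ∷ u₁) (e₂ ∷ u₂) (e₁ ∷ t)
  ne-r    : ∀ {e₁ e₂ u₁ u₂ t} → e₁ ≢ e₂ → cs e₁ ≡ false → cs e₂ ≡ false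
            → TMerge cs (e₁ ∷ u₁) u₂ t → TMerge cs (e₁ ∷ u₁) (e₂ ∷ u₂) (e₂ ∷ t)

_⊆ᵇ_ : ∀ {E : Set} → (E → Bool) → (E → Bool) → Set
A ⊆ᵇ B = ∀ e → T (A e) → T (B e)

N : ∀ {E S V₁ V₂} → Lens V₁ S → (E → Bool) → Lens V₂ S → MergeRel E S
N ns₁ cs ns₂ v v₀ v₁ v' =
  TMerge cs (tr v₀ -ₜ tr v) (tr v₁ -ₜ tr v) (tr v' -ₜ tr v)
  × ((tr v₀ -ₜ tr v) ↾ cs ≡ (tr v₁ -ₜ tr v) ↾ cs)
  × (ref v' ⊆ᵇ (λ e → ((ref v₀ e ∨ ref v₁ e) ∧ cs e)
                     ∨ ((ref v₀ e ∧ ref v₁ e) ∧ not (cs e))))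
  × (st v' ≡ (st v ⊕[ ns₁ ] st v₀) ⊕[ ns₂ ] st v₁)

N-I : ∀ {E S} → (E → Bool) → MergeRel E S
N-I cs = N zeroL cs zeroL

IPar : ∀ {E S} → (E → Bool) → Rel E S → Rel E S → Rel E S
IPar cs = ParBy (λ v v₀ v₁ v' → Σ _ λ σ → N-I cs v v₀ v₁ (obs (tr v') σ (ref v')))

FPar : ∀ {E S V₁ V₂} → Lens V₁ S → (E → Bool) → Lens V₂ S → Rel E S → Rel E S → Rel E S
FPar ns₁ cs ns₂ = ParBy (λ v v₀ v₁ v' → Σ (_ → Bool) λ r → N ns₁ cs ns₂ v v₀ v₁ (obs (tr v') (st v') r))

-- Swapping the branches of P ∥_M Q swaps the intermediate observations 0.v and 1.v,
-- so it suffices that the merge predicate is invariant under that swap. For N this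
-- holds because ∥_cs is commutative, the trace and refusal conditions are symmetric,
-- and overrides along independent lenses commute; 𝟎 is independent of itself.
module Submission where

open import Defs
open import Data.Bool using (Bool; T; _∧_; _∨_; not)
open import Data.Bool.Properties using (∨-comm; ∧-comm)
open import Data.Product using (Σ; _×_; _,_)
open import Relation.Binary.PropositionalEquality

TMerge-comm : ∀ {E : Set} {cs : E → Bool} {u₁ u₂ t} → TMerge cs u₁ u₂ t → TMerge cs u₂ u₁ t
TMerge-comm nil                  = nil
TMerge-comm (l-sync c)           = r-sync c
TMerge-comm (l-step c m)         = r-step c (TMerge-comm m)
TMerge-comm (r-sync c)           = l-sync c
TMerge-comm (r-step c m)         = l-step c (TMerge-comm m)
TMerge-comm (eq-sync c m)        = eq-sync c (TMerge-comm m)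
TMerge-comm (eq-l c m)           = eq-r c (TMerge-comm m)
TMerge-comm (eq-r c m)           = eq-l c (TMerge-comm m)
TMerge-comm (ne-both e≢ c₁ c₂)   = ne-both (≢-sym e≢) c₂ c₁
TMerge-comm (ne-fst e≢ c₁ c₂ m)  = ne-snd (≢-sym e≢) c₂ c₁ (TMerge-comm m)
TMerge-comm (ne-snd e≢ c₁ c₂ m)  = ne-fst (≢-sym e≢) c₂ c₁ (TMerge-comm m)
TMerge-comm (ne-l e≢ c₁ c₂ m)    = ne-r (≢-sym e≢) c₂ c₁ (TMerge-comm m)
TMerge-comm (ne-r e≢ c₁ c₂ m)    = ne-l (≢-sym e≢) c₂ c₁ (TMerge-comm m)

refusal-merge-comm : ∀ a b c →
  ((a ∨ b) ∧ c) ∨ ((a ∧ b) ∧ not c) ≡ ((b ∨ a) ∧ c) ∨ ((b ∧ a) ∧ not c)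
refusal-merge-comm a b c rewrite ∨-comm a b | ∧-comm a b = refl

⊕-comm : ∀ {V W S} (X : Lens V S) (Y : Lens W S) → Indep X Y →
  ∀ s a b → (s ⊕[ X ] a) ⊕[ Y ] b ≡ (s ⊕[ Y ] b) ⊕[ X ] a
⊕-comm X Y X⋈Y s a b = sym (X⋈Y s (get X a) (get Y b))

Indep-sym : ∀ {V W S} (X : Lens V S) (Y : Lens W S) → Indep X Y → Indep Y X
Indep-sym X Y X⋈Y s u v = sym (X⋈Y s v u)

zeroL-indep : ∀ {S} → Indep (zeroL {S}) (zeroL {S})
zeroL-indep s u v = refl

N-comm : ∀ {E S V₁ V₂} (ns₁ : Lens V₁ S) (ns₂ : Lens V₂ S) {cs : E → Bool} →
  Indep ns₁ ns₂ → ∀ v v₀ v₁ v' → N ns₁ cs ns₂ v v₀ v₁ v' → N ns₂ cs ns₁ v v₁ v₀ v'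
N-comm ns₁ ns₂ {cs} ns₁⋈ns₂ v v₀ v₁ v' (merge , sync , refusal , state) =
    TMerge-comm merge
  , sym sync
  , (λ e r → subst T (refusal-merge-comm (ref v₀ e) (ref v₁ e) (cs e)) (refusal e r))
  , trans state (⊕-comm ns₁ ns₂ ns₁⋈ns₂ (st v) (st v₀) (st v₁))

ParBy-swap : ∀ {E S} {M M' : MergeRel E S} →
  (∀ v v₀ v₁ v' → M v v₀ v₁ v' → M' v v₁ v₀ v') →
  ∀ (P Q : Rel E S) s s' → ParBy M P Q s s' → ParBy M' Q P s s'
ParBy-swap M⇒M' P Q s s' (o₀ , o₁ , p , q , m) = o₁ , o₀ , q , p , M⇒M' s o₀ o₁ s' m

ParBy-comm : ∀ {E S} {M M' : MergeRel E S} →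
  (∀ v v₀ v₁ v' → M v v₀ v₁ v' → M' v v₁ v₀ v') →
  (∀ v v₀ v₁ v' → M' v v₀ v₁ v' → M v v₁ v₀ v') →
  ∀ (P Q : Rel E S) → ParBy M P Q ≐ ParBy M' Q P
ParBy-comm M⇒M' M'⇒M P Q s s' = ParBy-swap M⇒M' P Q s s' , ParBy-swap M'⇒M Q P s s'

IPar-comm : ∀ {E S} (cs : E → Bool) (P Q : Rel E S) → IPar cs P Q ≐ IPar cs Q P
IPar-comm cs = ParBy-comm N-I-comm N-I-comm
  where
  N-I-comm : ∀ v v₀ v₁ v' → (Σ _ λ σ → N-I cs v v₀ v₁ (obs (tr v') σ (ref v')))
                          → (Σ _ λ σ → N-I cs v v₁ v₀ (obs (tr v') σ (ref v')))
  N-I-comm v v₀ v₁ v' (σ , n) = σ , N-comm zeroL zeroL zeroL-indep v v₀ v₁ _ n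

FPar-comm : ∀ {E S V₁ V₂} (ns₁ : Lens V₁ S) (ns₂ : Lens V₂ S) → Indep ns₁ ns₂ →
  (cs : E → Bool) (P Q : Rel E S) → FPar ns₁ cs ns₂ P Q ≐ FPar ns₂ cs ns₁ Q P
FPar-comm ns₁ ns₂ ns₁⋈ns₂ cs =
  ParBy-comm (N-swap ns₁ ns₂ ns₁⋈ns₂) (N-swap ns₂ ns₁ (Indep-sym ns₁ ns₂ ns₁⋈ns₂))
  where
  N-swap : ∀ {W₁ W₂} (X : Lens W₁ _) (Y : Lens W₂ _) → Indep X Y → ∀ v v₀ v₁ v' →
    (Σ (_ → Bool) λ r → N X cs Y v v₀ v₁ (obs (tr v') (st v') r)) →
    (Σ (_ → Bool) λ r → N Y cs X v v₁ v₀ (obs (tr v') (st v') r))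
  N-swap X Y X⋈Y v v₀ v₁ v' (r , n) = r , N-comm X Y X⋈Y v v₀ v₁ _ n

theorem36 : {E S : Set}
    → ((cs : E → Bool) (P Q : Rel E S) → IPar cs P Q ≐ IPar cs Q P)
    × ({V₁ V₂ : Set} (ns₁ : Lens V₁ S) (ns₂ : Lens V₂ S) → Indep ns₁ ns₂
       → (cs : E → Bool) (P Q : Rel E S) → FPar ns₁ cs ns₂ P Q ≐ FPar ns₂ cs ns₁ Q P)
theorem36 = IPar-comm , FPar-comm
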